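{- If $\mathcal{E}$ is a locally cartesian closed model of guarded recursive terms, then so is every slice $\mathcal{E}/I$, with later functor $\blacktriangleright_I$ and transformation $\mathrm{next}$ on $\mathcal{E}/I$ as defined in the context.
   Context: A model of guarded recursive terms is a category $\mathcal{E}$ with finite products together with an endofunctor $\blacktriangleright:\mathcal{E}\to\mathcal{E}$ preserving finite limits and a natural transformation $\mathrm{next}:\mathrm{id}\to\blacktriangleright$ such that for every $f:\blacktriangleright X\to X$ there exists a unique $h:1\to X$ with $f\circ\mathrm{next}\circ h=h$. On $\mathcal{E}/I$, $\blacktriangleright_I$ is the composite $\mathcal{E}/I\to\mathcal{E}/\blacktriangleright I\to\mathcal{E}/I$ sending $p_X:X\to I$ first to $\blacktriangleright p_X:\blacktriangleright X\to\blacktriangleright I$ and then pulling back along $\mathrm{next}_I:I\to\blacktriangleright I$; the component of $\mathrm{next}$ at $p_Y$ is the map $Y\to\blacktriangleright_I Y$ into the pullback induced by $p_Y:Y\to I$ and $\mathrm{next}_Y:Y\to\blacktriangleright Y$. -}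

module Defs where

open import Level using (Level; _⊔_) renaming (suc to lsuc; zero to lzero)
open import Data.Unit using (⊤)
open import Data.Product using (Σ; _,_; proj₁; proj₂; _×_; Σ-syntax)
open import Relation.Binary using (IsEquivalence; Setoid)
import Relation.Binary.Reasoning.Setoid as SetoidR

record Category (o ℓ e : Level) : Set (lsuc (o ⊔ ℓ ⊔ e)) where
  infix  4 _≈_
  infixr 9 _∘_
  field
    Obj       : Set o
    Hom       : Obj → Obj → Set ℓ
    _≈_       : ∀ {A B} → Hom A B → Hom A B → Set e
    id        : ∀ {A} → Hom A A
    _∘_       : ∀ {A B C} → Hom B C → Hom A B → Hom A C
    equiv     : ∀ {A B} → IsEquivalence (_≈_ {A} {B})
    assoc     : ∀ {A B C D} {f : Hom A B} {g : Hom B C} {h : Hom C D} →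
                (h ∘ g) ∘ f ≈ h ∘ (g ∘ f)
    identityˡ : ∀ {A B} {f : Hom A B} → id ∘ f ≈ f
    identityʳ : ∀ {A B} {f : Hom A B} → f ∘ id ≈ f
    ∘-resp-≈  : ∀ {A B C} {f h : Hom B C} {g i : Hom A B} →
                f ≈ h → g ≈ i → f ∘ g ≈ h ∘ i

  hom-setoid : Obj → Obj → Setoid ℓ e
  hom-setoid A B = record { Carrier = Hom A B ; _≈_ = _≈_ ; isEquivalence = equiv }

  ≈-refl : ∀ {A B} {f : Hom A B} → f ≈ f
  ≈-refl = IsEquivalence.refl equiv

  ≈-sym : ∀ {A B} {f g : Hom A B} → f ≈ g → g ≈ f
  ≈-sym = IsEquivalence.sym equiv

  ≈-trans : ∀ {A B} {f g h : Hom A B} → f ≈ g → g ≈ h → f ≈ h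
  ≈-trans = IsEquivalence.trans equiv

  ∃!Hom : ∀ {p} (A B : Obj) → (Hom A B → Set p) → Set (ℓ ⊔ e ⊔ p)
  ∃!Hom A B P = Σ[ u ∈ Hom A B ] (P u × (∀ v → P v → v ≈ u))

module _ {o ℓ e} (C : Category o ℓ e) where
  open Category C

  IsTerminal : Obj → Set (o ⊔ ℓ ⊔ e)
  IsTerminal T = ∀ X → ∃!Hom X T (λ _ → ⊤)

  IsProduct : (A B P : Obj) → Hom P A → Hom P B → Set (o ⊔ ℓ ⊔ e)
  IsProduct A B P π₁ π₂ =
    ∀ X (f : Hom X A) (g : Hom X B) →
      ∃!Hom X P (λ u → (π₁ ∘ u ≈ f) × (π₂ ∘ u ≈ g))

  IsPullback : ∀ {A B Z P} (f : Hom A Z) (g : Hom B Z) →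
               Hom P A → Hom P B → Set (o ⊔ ℓ ⊔ e)
  IsPullback {A} {B} {Z} {P} f g p₁ p₂ =
    (f ∘ p₁ ≈ g ∘ p₂) ×
    (∀ X (h : Hom X A) (k : Hom X B) → f ∘ h ≈ g ∘ k →
       ∃!Hom X P (λ u → (p₁ ∘ u ≈ h) × (p₂ ∘ u ≈ k)))

  record Terminal : Set (o ⊔ ℓ ⊔ e) where
    field
      ⊤obj       : Obj
      isTerminal : IsTerminal ⊤obj

  record Product (A B : Obj) : Set (o ⊔ ℓ ⊔ e) where
    field
      A×B       : Obj
      π₁        : Hom A×B A
      π₂        : Hom A×B B
      isProduct : IsProduct A B A×B π₁ π₂

    ⟨_,_⟩ : ∀ {X} → Hom X A → Hom X B → Hom X A×B
    ⟨ f , g ⟩ = proj₁ (isProduct _ f g)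

  record Pullback {A B Z : Obj} (f : Hom A Z) (g : Hom B Z) : Set (o ⊔ ℓ ⊔ e) where
    field
      P          : Obj
      p₁         : Hom P A
      p₂         : Hom P B
      isPullback : IsPullback f g p₁ p₂

  HasPullbacks : Set (o ⊔ ℓ ⊔ e)
  HasPullbacks = ∀ {A B Z} (f : Hom A Z) (g : Hom B Z) → Pullback f g

  record HasFiniteProducts : Set (o ⊔ ℓ ⊔ e) where
    field
      terminal : Terminal
      product  : ∀ A B → Product A B

    𝟙 : Obj
    𝟙 = Terminal.⊤obj terminal

    _×ₒ_ : Obj → Obj → Obj
    A ×ₒ B = Product.A×B (product A B)

    _⁂id : ∀ {X Y A} → Hom X Y → Hom (X ×ₒ A) (Y ×ₒ A)
    _⁂id {X} {Y} {A} u =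
      Product.⟨_,_⟩ (product Y A) (u ∘ Product.π₁ (product X A)) (Product.π₂ (product X A))

  record Exponential (fp : HasFiniteProducts) (A B : Obj) : Set (o ⊔ ℓ ⊔ e) where
    open HasFiniteProducts fp
    field
      B^A   : Obj
      eval  : Hom (B^A ×ₒ A) B
      curry : ∀ X (f : Hom (X ×ₒ A) B) → ∃!Hom X B^A (λ u → eval ∘ (u ⁂id) ≈ f)

  record CartesianClosed : Set (o ⊔ ℓ ⊔ e) where
    field
      finiteProducts : HasFiniteProducts
      exponential    : ∀ A B → Exponential finiteProducts A B

Slice : ∀ {o ℓ e} (C : Category o ℓ e) → Category.Obj C → Category (o ⊔ ℓ) (ℓ ⊔ e) e
Slice {o} {ℓ} {e} C I = record
  { Obj       = Σ[ X ∈ Obj ] Hom X I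
  ; Hom       = λ { (X , p) (Y , q) → Σ[ f ∈ Hom X Y ] (q ∘ f ≈ p) }
  ; _≈_       = λ f g → proj₁ f ≈ proj₁ g
  ; id        = λ { {X , p} → id , identityʳ }
  ; _∘_       = λ { {X , p} {Y , q} {Z , r} (g , gc) (f , fc) → g ∘ f , comp gc fc }
  ; equiv     = record { refl = ≈-refl ; sym = ≈-sym ; trans = ≈-trans }
  ; assoc     = assoc
  ; identityˡ = identityˡ
  ; identityʳ = identityʳ
  ; ∘-resp-≈  = ∘-resp-≈
  }
  where
  open Category C
  comp : ∀ {X Y Z} {p : Hom X I} {q : Hom Y I} {r : Hom Z I} {g : Hom Y Z} {f : Hom X Y} →
         r ∘ g ≈ q → q ∘ f ≈ p → r ∘ (g ∘ f) ≈ p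
  comp {r = r} {g} {f} gc fc =
    ≈-trans (≈-sym assoc) (≈-trans (∘-resp-≈ gc ≈-refl) fc)

record LCCC {o ℓ e} (C : Category o ℓ e) : Set (lsuc (o ⊔ ℓ ⊔ e)) where
  field
    terminal        : Terminal C
    pullback        : HasPullbacks C
    sliceCartClosed : ∀ I → CartesianClosed (Slice C I)

module _ {o ℓ e} (C : Category o ℓ e) where
  open Category C

  record IsEndofunctor (F₀ : Obj → Obj) (F₁ : ∀ {A B} → Hom A B → Hom (F₀ A) (F₀ B))
         : Set (o ⊔ ℓ ⊔ e) where
    field
      F-id     : ∀ {A} → F₁ (id {A}) ≈ id
      F-∘      : ∀ {A B C} {f : Hom A B} {g : Hom B C} → F₁ (g ∘ f) ≈ F₁ g ∘ F₁ f
      F-resp-≈ : ∀ {A B} {f g : Hom A B} → f ≈ g → F₁ f ≈ F₁ g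

  record PreservesFiniteLimits (F₀ : Obj → Obj) (F₁ : ∀ {A B} → Hom A B → Hom (F₀ A) (F₀ B))
         : Set (o ⊔ ℓ ⊔ e) where
    field
      pres-terminal : ∀ T → IsTerminal C T → IsTerminal C (F₀ T)
      pres-pullback : ∀ {A B Z P} (f : Hom A Z) (g : Hom B Z) (p₁ : Hom P A) (p₂ : Hom P B) →
                      IsPullback C f g p₁ p₂ →
                      IsPullback C (F₁ f) (F₁ g) (F₁ p₁) (F₁ p₂)

  IsNaturalFromId : (F₀ : Obj → Obj) (F₁ : ∀ {A B} → Hom A B → Hom (F₀ A) (F₀ B)) →
                    (∀ X → Hom X (F₀ X)) → Set (o ⊔ ℓ ⊔ e)
  IsNaturalFromId F₀ F₁ η = ∀ {X Y} (f : Hom X Y) → η Y ∘ f ≈ F₁ f ∘ η X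

  record IsGuardedModel (fp : HasFiniteProducts C)
         (▶₀ : Obj → Obj) (▶₁ : ∀ {A B} → Hom A B → Hom (▶₀ A) (▶₀ B))
         (next : ∀ X → Hom X (▶₀ X)) : Set (o ⊔ ℓ ⊔ e) where
    open HasFiniteProducts fp
    field
      isEndofunctor : IsEndofunctor ▶₀ ▶₁
      presFinLimits : PreservesFiniteLimits ▶₀ ▶₁
      nextNatural   : IsNaturalFromId ▶₀ ▶₁ next
      guardedFix    : ∀ X (f : Hom (▶₀ X) X) →
                      ∃!Hom 𝟙 X (λ h → f ∘ next X ∘ h ≈ h)

  record GuardedModel : Set (o ⊔ ℓ ⊔ e) where
    field
      finiteProducts : HasFiniteProducts C
      ▶₀             : Obj → Obj
      ▶₁             : ∀ {A B} → Hom A B → Hom (▶₀ A) (▶₀ B)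
      next           : ∀ X → Hom X (▶₀ X)
      isGuardedModel : IsGuardedModel finiteProducts ▶₀ ▶₁ next

module SliceLater {o ℓ e} (E : Category o ℓ e) (L : LCCC E) (M : GuardedModel E)
                  (I : Category.Obj E) where
  open Category E
  open LCCC L using (pullback)
  open GuardedModel M
  open IsGuardedModel isGuardedModel
  open IsEndofunctor isEndofunctor

  private
    module EI = Category (Slice E I)

  pb : (X : Obj) (p : Hom X I) → Pullback E (▶₁ p) (next I)
  pb X p = pullback (▶₁ p) (next I)

  ▶I₀ : EI.Obj → EI.Obj
  ▶I₀ (X , p) = Pullback.P (pb X p) , Pullback.p₂ (pb X p)

  ▶I₁ : ∀ {A B} → EI.Hom A B → EI.Hom (▶I₀ A) (▶I₀ B)
  ▶I₁ {X , p} {Y , q} (f , fc) = proj₁ univ , proj₂ (proj₁ (proj₂ univ))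
    where
    module PX = Pullback (pb X p)
    module PY = Pullback (pb Y q)
    sq : ▶₁ q ∘ (▶₁ f ∘ PX.p₁) ≈ next I ∘ PX.p₂
    sq = ≈-trans (≈-sym assoc)
         (≈-trans (∘-resp-≈ (≈-sym F-∘) ≈-refl)
         (≈-trans (∘-resp-≈ (F-resp-≈ fc) ≈-refl)
                  (proj₁ PX.isPullback)))
    univ = proj₂ PY.isPullback _ (▶₁ f ∘ PX.p₁) PX.p₂ sq

  nextI : ∀ A → EI.Hom A (▶I₀ A)
  nextI (Y , p) = proj₁ univ , proj₂ (proj₁ (proj₂ univ))
    where
    module PY = Pullback (pb Y p)
    univ = proj₂ PY.isPullback Y (next Y) p (≈-sym (nextNatural p))

module Submission where

-- 1. E/I is again locally cartesian closed: its terminal object is (I , id),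
--    pullbacks are computed in E, and a slice (E/I)/(J , j) is isomorphic
--    to E/J, hence cartesian closed.
-- 2. ▶_I is a functor preserving the terminal object and pullbacks, and
--    next is natural; all of this is checked on the pullback legs of ▶_I X.
-- 3. Guarded fixed points in E/I.  Points 𝟙 → S of the object of sections
--    S = Π_I X (the pullback of p^I : X^I → I^I along the name of id_I)
--    correspond bijectively to sections I → X of p.  A map f : ▶_I X → X
--    over I induces F : ▶S → S, and the bijection turns F ∘ next ∘ -
--    into f ∘ next_I ∘ -; so the unique fixed point of the former (given
--    by the guarded model E) transfers to a unique fixed point of the latter.

open import Level using (_⊔_)
open import Data.Unit using (tt)
open import Data.Product using (_,_; proj₁; proj₂; _×_; Σ-syntax)
open import Relation.Binary using (Setoid)
import Relation.Binary.Reasoning.Setoid as SetoidReasoning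
open import Defs

module CategoryReasoning {o ℓ e} (E : Category o ℓ e) where
  open Category E public

  infixr 2 _≈⟨_⟩_
  infix 3 _∎
  infix 1 begin_
  begin_ : ∀ {A B} {f g : Hom A B} → f ≈ g → f ≈ g
  begin p = p
  _≈⟨_⟩_ : ∀ {A B} (f : Hom A B) {g h : Hom A B} → f ≈ g → g ≈ h → f ≈ h
  _ ≈⟨ p ⟩ q = ≈-trans p q
  _∎ : ∀ {A B} (f : Hom A B) → f ≈ f
  _ ∎ = ≈-refl

  infixr 4 _⟩∘⟨_ refl⟩∘⟨_
  infixl 5 _⟩∘⟨refl
  _⟩∘⟨_ : ∀ {A B C} {f h : Hom B C} {g i : Hom A B} → f ≈ h → g ≈ i → f ∘ g ≈ h ∘ i
  _⟩∘⟨_ = ∘-resp-≈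
  refl⟩∘⟨_ : ∀ {A B C} {f : Hom B C} {g i : Hom A B} → g ≈ i → f ∘ g ≈ f ∘ i
  refl⟩∘⟨ p = ∘-resp-≈ ≈-refl p
  _⟩∘⟨refl : ∀ {A B C} {f h : Hom B C} {g : Hom A B} → f ≈ h → f ∘ g ≈ h ∘ g
  p ⟩∘⟨refl = ∘-resp-≈ p ≈-refl

  sym-assoc : ∀ {A B C D} {f : Hom A B} {g : Hom B C} {h : Hom C D} →
              h ∘ (g ∘ f) ≈ (h ∘ g) ∘ f
  sym-assoc = ≈-sym assoc

  pullˡ : ∀ {A B C D} {f : Hom B C} {g : Hom C D} {h : Hom B D} {k : Hom A B} →
          g ∘ f ≈ h → g ∘ (f ∘ k) ≈ h ∘ k
  pullˡ p = ≈-trans sym-assoc (p ⟩∘⟨refl)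
  pushˡ : ∀ {A B C D} {f : Hom B C} {g : Hom C D} {h : Hom B D} {k : Hom A B} →
          g ∘ f ≈ h → h ∘ k ≈ g ∘ (f ∘ k)
  pushˡ p = ≈-sym (pullˡ p)
  pullʳ : ∀ {A B C D} {f : Hom A B} {g : Hom B C} {h : Hom A C} {k : Hom C D} →
          g ∘ f ≈ h → (k ∘ g) ∘ f ≈ k ∘ h
  pullʳ p = ≈-trans assoc (refl⟩∘⟨ p)

  module PullbackProps {A B Z P} {f : Hom A Z} {g : Hom B Z} {p₁ : Hom P A} {p₂ : Hom P B}
                       (pb : IsPullback E f g p₁ p₂) where
    comm : f ∘ p₁ ≈ g ∘ p₂
    comm = proj₁ pb
    med : ∀ {X} (h : Hom X A) (k : Hom X B) → f ∘ h ≈ g ∘ k → Hom X P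
    med h k c = proj₁ (proj₂ pb _ h k c)
    med₁ : ∀ {X} {h : Hom X A} {k : Hom X B} (c : f ∘ h ≈ g ∘ k) → p₁ ∘ med h k c ≈ h
    med₁ c = proj₁ (proj₁ (proj₂ (proj₂ pb _ _ _ c)))
    med₂ : ∀ {X} {h : Hom X A} {k : Hom X B} (c : f ∘ h ≈ g ∘ k) → p₂ ∘ med h k c ≈ k
    med₂ c = proj₂ (proj₁ (proj₂ (proj₂ pb _ _ _ c)))
    med-unique : ∀ {X} {h : Hom X A} {k : Hom X B} (c : f ∘ h ≈ g ∘ k) (v : Hom X P) →
                 p₁ ∘ v ≈ h → p₂ ∘ v ≈ k → v ≈ med h k c
    med-unique c v e₁ e₂ = proj₂ (proj₂ (proj₂ pb _ _ _ c)) v (e₁ , e₂)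
    jointly-monic : ∀ {X} {x y : Hom X P} → p₁ ∘ x ≈ p₁ ∘ y → p₂ ∘ x ≈ p₂ ∘ y → x ≈ y
    jointly-monic {x = x} {y} e₁ e₂ =
      ≈-trans (med-unique c x e₁ e₂) (≈-sym (med-unique c y ≈-refl ≈-refl))
      where
      c : f ∘ (p₁ ∘ y) ≈ g ∘ (p₂ ∘ y)
      c = ≈-trans sym-assoc (≈-trans (comm ⟩∘⟨refl) assoc)

module ProductProps {o ℓ e} {C : Category o ℓ e} {A B} (Pr : Product C A B) where
  open Category C
  open Product Pr
  pair-β₁ : ∀ {X} {f : Hom X A} {g : Hom X B} → π₁ ∘ ⟨ f , g ⟩ ≈ f
  pair-β₁ = proj₁ (proj₁ (proj₂ (isProduct _ _ _)))
  pair-β₂ : ∀ {X} {f : Hom X A} {g : Hom X B} → π₂ ∘ ⟨ f , g ⟩ ≈ g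
  pair-β₂ = proj₂ (proj₁ (proj₂ (isProduct _ _ _)))
  pair-unique : ∀ {X} {f : Hom X A} {g : Hom X B} (v : Hom X A×B) →
                π₁ ∘ v ≈ f → π₂ ∘ v ≈ g → v ≈ ⟨ f , g ⟩
  pair-unique v e₁ e₂ = proj₂ (proj₂ (isProduct _ _ _)) v (e₁ , e₂)
  pair-resp : ∀ {X} {f f' : Hom X A} {g g' : Hom X B} → f ≈ f' → g ≈ g' →
              ⟨ f , g ⟩ ≈ ⟨ f' , g' ⟩
  pair-resp ef eg = pair-unique _ (≈-trans pair-β₁ ef) (≈-trans pair-β₂ eg)

terminal-unique : ∀ {o ℓ e} (C : Category o ℓ e) {T : Category.Obj C} → IsTerminal C T →
                  ∀ {X} (u v : Category.Hom C X T) → Category._≈_ C u v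
terminal-unique C isT {X} u v =
  ≈-trans (proj₂ (proj₂ (isT X)) u tt) (≈-sym (proj₂ (proj₂ (isT X)) v tt))
  where open Category C

-- Part 1: every slice of a locally cartesian closed category is locally
-- cartesian closed.
module SliceLCCC {o ℓ e} (E : Category o ℓ e) where
  open CategoryReasoning E

  sliceTerminal : ∀ I → Terminal (Slice E I)
  sliceTerminal I = record
    { ⊤obj = I , id
    ; isTerminal = λ { (X , x) →
        (x , identityˡ) , tt , λ v _ → ≈-trans (≈-sym identityˡ) (proj₂ v) } }

  slicePullbacks : ∀ I → HasPullbacks E → HasPullbacks (Slice E I)
  slicePullbacks I pbs {A , a} {B , b} {Z , z} (f , fc) (g , gc) = record
    { P = P , a ∘ p₁
    ; p₁ = p₁ , ≈-refl
    ; p₂ = p₂ , p₂-over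
    ; isPullback = comm , λ { (X , x) (h , hc) (k , kc) c →
        (med h k c , ≈-trans (pullʳ (med₁ c)) hc) , (med₁ c , med₂ c) ,
        λ v ev → med-unique c (proj₁ v) (proj₁ ev) (proj₂ ev) } }
    where
    open Pullback (pbs f g)
    open PullbackProps isPullback
    p₂-over : b ∘ p₂ ≈ a ∘ p₁
    p₂-over = begin
      b ∘ p₂       ≈⟨ ≈-sym gc ⟩∘⟨refl ⟩
      (z ∘ g) ∘ p₂ ≈⟨ pullʳ (≈-sym comm) ⟩
      z ∘ (f ∘ p₁) ≈⟨ sym-assoc ⟩
      (z ∘ f) ∘ p₁ ≈⟨ fc ⟩∘⟨refl ⟩
      a ∘ p₁       ∎

  -- (E/I)/(J , j) is isomorphic to E/J: an object over (J , j) is an object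
  -- X → J of E/J (its map to I is forced), and so are the morphisms.  Hence
  -- a cartesian closed structure on E/J transfers to (E/I)/(J , j).
  module SliceOfSlice (I J : Obj) (j : Hom J I) (cc : CartesianClosed (Slice E J)) where
    D : Category (o ⊔ ℓ) (ℓ ⊔ e) e
    D = Slice E J
    S : Category (o ⊔ ℓ ⊔ (ℓ ⊔ e)) (ℓ ⊔ e ⊔ e) e
    S = Slice (Slice E I) (J , j)
    module D = Category D
    module S = Category S

    forget : S.Obj → D.Obj
    forget ((X , _) , (f , _)) = X , f

    over : D.Obj → S.Obj
    over (X , f) = (X , j ∘ f) , (f , ≈-refl)

    forget₁ : ∀ {a b} → S.Hom a b → D.Hom (forget a) (forget b)
    forget₁ ((h , _) , hc) = h , hc

    lift : ∀ {a b} → D.Hom (forget a) (forget b) → S.Hom a b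
    lift {(X , p) , (f , fc)} {(Y , q) , (g , gc)} (h , hc) =
      (h , (begin
        q ∘ h       ≈⟨ ≈-sym gc ⟩∘⟨refl ⟩
        (j ∘ g) ∘ h ≈⟨ pullʳ hc ⟩
        j ∘ f       ≈⟨ fc ⟩
        p           ∎)) , hc

    open CartesianClosed cc
    open HasFiniteProducts finiteProducts

    terminalS : Terminal S
    terminalS = record
      { ⊤obj = over 𝟙
      ; isTerminal = λ a →
          lift {a} {over 𝟙} (proj₁ (Terminal.isTerminal terminal (forget a))) , tt ,
          λ v _ → proj₂ (proj₂ (Terminal.isTerminal terminal (forget a)))
                    (forget₁ {a} {over 𝟙} v) tt }

    productS : ∀ a b → Product S a b
    productS a b = record
      { A×B = over (Product.A×B Pr)
      ; π₁ = lift {over (Product.A×B Pr)} {a} (Product.π₁ Pr)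
      ; π₂ = lift {over (Product.A×B Pr)} {b} (Product.π₂ Pr)
      ; isProduct = λ X f g →
          let r = Product.isProduct Pr (forget X) (forget₁ {X} {a} f) (forget₁ {X} {b} g) in
          lift {X} {over (Product.A×B Pr)} (proj₁ r) , proj₁ (proj₂ r) ,
          λ v ev → proj₂ (proj₂ r) (forget₁ {X} {over (Product.A×B Pr)} v) ev }
      where Pr = product (forget a) (forget b)

    finiteProductsS : HasFiniteProducts S
    finiteProductsS = record { terminal = terminalS ; product = productS }

    exponentialS : ∀ a b → Exponential S finiteProductsS a b
    exponentialS a b = record
      { B^A = over B^A
      ; eval = lift {over (Product.A×B (product B^A (forget a)))} {b} eval
      ; curry = λ X f →
          let r = curry (forget X)
                    (forget₁ {over (Product.A×B (product (forget X) (forget a)))} {b} f) in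
          lift {X} {over B^A} (proj₁ r) ,
          ≈-trans (refl⟩∘⟨ pair-resp ≈-refl ≈-refl) (proj₁ (proj₂ r)) ,
          λ v ev → proj₂ (proj₂ r) (forget₁ {X} {over B^A} v)
                     (≈-trans (refl⟩∘⟨ pair-resp ≈-refl ≈-refl) ev) }
      where
      -- ⁂id of S and of D agree only up to pairing with equal components
      open Exponential (exponential (forget a) (forget b))
      open ProductProps (product B^A (forget a))

    cartesianClosedS : CartesianClosed S
    cartesianClosedS = record { finiteProducts = finiteProductsS ; exponential = exponentialS }

  sliceLCCC : LCCC E → ∀ I → LCCC (Slice E I)
  sliceLCCC L I = record
    { terminal = sliceTerminal I
    ; pullback = slicePullbacks I (LCCC.pullback L)
    ; sliceCartClosed = λ { (J , j) →
        SliceOfSlice.cartesianClosedS I J j (LCCC.sliceCartClosed L J) } }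

-- Part 2: ▶_I is an endofunctor of E/I preserving finite limits, and next
-- is natural.  ▶_I (X , p) is the pullback Q of ▶p along next_I, so every
-- equation between maps into it is checked on the two legs q₁ : Q → ▶X and
-- q₂ : Q → I.
module SliceLaterFunctor {o ℓ e} (E : Category o ℓ e) (L : LCCC E) (M : GuardedModel E)
                         (I : Category.Obj E) where
  open CategoryReasoning E
  open SliceLater E L M I
  open GuardedModel M
  open IsGuardedModel isGuardedModel
  open IsEndofunctor isEndofunctor
  open PreservesFiniteLimits presFinLimits

  EI : Category (o ⊔ ℓ) (ℓ ⊔ e) e
  EI = Slice E I
  module EI = Category EI

  module Q (Y : Obj) (y : Hom Y I) where
    open Pullback (pb Y y) public renaming (P to Q; p₁ to q₁; p₂ to q₂)
    open PullbackProps isPullback public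

  -- first leg of ▶_I f (the second leg is the slice condition of ▶_I f)
  ▶I₁-q₁ : ∀ {X p Y q} (f : EI.Hom (X , p) (Y , q)) →
           Q.q₁ Y q ∘ proj₁ (▶I₁ {X , p} {Y , q} f) ≈ ▶₁ (proj₁ f) ∘ Q.q₁ X p
  ▶I₁-q₁ {X} {p} {Y} {q} (f , fc) = Q.med₁ Y q square
    where
    -- the square of the definition of ▶I₁, which is local to Defs
    square : ▶₁ q ∘ (▶₁ f ∘ Q.q₁ X p) ≈ next I ∘ Q.q₂ X p
    square = ≈-trans (≈-sym assoc)
             (≈-trans (∘-resp-≈ (≈-sym F-∘) ≈-refl)
             (≈-trans (∘-resp-≈ (F-resp-≈ fc) ≈-refl)
                      (Q.comm X p)))

  nextI-q₁ : ∀ Y y → Q.q₁ Y y ∘ proj₁ (nextI (Y , y)) ≈ next Y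
  nextI-q₁ Y y = Q.med₁ Y y (≈-sym (nextNatural y))

  ▶I₁-unique : ∀ {X p Y q} (f : EI.Hom (X , p) (Y , q)) (k : Hom (Q.Q X p) (Q.Q Y q)) →
               Q.q₁ Y q ∘ k ≈ ▶₁ (proj₁ f) ∘ Q.q₁ X p → Q.q₂ Y q ∘ k ≈ Q.q₂ X p →
               k ≈ proj₁ (▶I₁ {X , p} {Y , q} f)
  ▶I₁-unique {X} {p} {Y} {q} f k e₁ e₂ =
    Q.jointly-monic Y q (≈-trans e₁ (≈-sym (▶I₁-q₁ f)))
      (≈-trans e₂ (≈-sym (proj₂ (▶I₁ {X , p} {Y , q} f))))

  ▶I-endofunctor : IsEndofunctor EI ▶I₀ ▶I₁
  ▶I-endofunctor = record
    { F-id = λ { {X , p} → ≈-sym (▶I₁-unique {X} {p} {X} {p} EI.id id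
               (≈-trans identityʳ (≈-trans (≈-sym identityˡ) (≈-sym F-id ⟩∘⟨refl)))
               identityʳ) }
    ; F-∘ = λ { {X , p} {Y , q} {Z , r} {f} {g} →
        let f' = ▶I₁ {X , p} {Y , q} f ; g' = ▶I₁ {Y , q} {Z , r} g in
        ≈-sym (▶I₁-unique {X} {p} {Z} {r} (g EI.∘ f) (proj₁ g' ∘ proj₁ f')
          (begin
            Q.q₁ Z r ∘ (proj₁ g' ∘ proj₁ f')       ≈⟨ pullˡ (▶I₁-q₁ g) ⟩
            (▶₁ (proj₁ g) ∘ Q.q₁ Y q) ∘ proj₁ f'   ≈⟨ pullʳ (▶I₁-q₁ f) ⟩
            ▶₁ (proj₁ g) ∘ (▶₁ (proj₁ f) ∘ Q.q₁ X p) ≈⟨ sym-assoc ⟩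
            (▶₁ (proj₁ g) ∘ ▶₁ (proj₁ f)) ∘ Q.q₁ X p ≈⟨ ≈-sym F-∘ ⟩∘⟨refl ⟩
            ▶₁ (proj₁ g ∘ proj₁ f) ∘ Q.q₁ X p        ∎)
          (≈-trans (pullˡ (proj₂ g')) (proj₂ f'))) }
    ; F-resp-≈ = λ { {X , p} {Y , q} {f} {g} f≈g →
        ▶I₁-unique {X} {p} {Y} {q} g (proj₁ (▶I₁ {X , p} {Y , q} f))
          (≈-trans (▶I₁-q₁ f) (F-resp-≈ f≈g ⟩∘⟨refl)) (proj₂ (▶I₁ {X , p} {Y , q} f)) } }

  nextI-natural : IsNaturalFromId EI ▶I₀ ▶I₁ nextI
  nextI-natural {X , p} {Y , q} (f , fc) =
    Q.jointly-monic Y q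
      (begin
        Q.q₁ Y q ∘ (nY ∘ f)                 ≈⟨ pullˡ (nextI-q₁ Y q) ⟩
        next Y ∘ f                          ≈⟨ nextNatural f ⟩
        ▶₁ f ∘ next X                       ≈⟨ refl⟩∘⟨ ≈-sym (nextI-q₁ X p) ⟩
        ▶₁ f ∘ (Q.q₁ X p ∘ nX)              ≈⟨ sym-assoc ⟩
        (▶₁ f ∘ Q.q₁ X p) ∘ nX              ≈⟨ ≈-sym (▶I₁-q₁ (f , fc)) ⟩∘⟨refl ⟩
        (Q.q₁ Y q ∘ ▶f) ∘ nX                ≈⟨ assoc ⟩
        Q.q₁ Y q ∘ (▶f ∘ nX)                ∎)
      (begin
        Q.q₂ Y q ∘ (nY ∘ f)                 ≈⟨ pullˡ (proj₂ (nextI (Y , q))) ⟩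
        q ∘ f                               ≈⟨ fc ⟩
        p                                   ≈⟨ ≈-sym (proj₂ (nextI (X , p))) ⟩
        Q.q₂ X p ∘ nX                       ≈⟨ ≈-sym (proj₂ (▶I₁ {X , p} {Y , q} (f , fc))) ⟩∘⟨refl ⟩
        (Q.q₂ Y q ∘ ▶f) ∘ nX                ≈⟨ assoc ⟩
        Q.q₂ Y q ∘ (▶f ∘ nX)                ∎)
    where
    nX : Hom X (Q.Q X p)
    nX = proj₁ (nextI (X , p))
    nY : Hom Y (Q.Q Y q)
    nY = proj₁ (nextI (Y , q))
    ▶f : Hom (Q.Q X p) (Q.Q Y q)
    ▶f = proj₁ (▶I₁ {X , p} {Y , q} (f , fc))

  -- a terminal (T , t) of E/I has t invertible, so ▶t is invertible and
  -- ▶_I (T , t) ≅ ▶_I (I , id), whose sections over any x are forced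
  ▶I-presTerminal : ∀ T → IsTerminal EI T → IsTerminal EI (▶I₀ T)
  ▶I-presTerminal (T , t) isT (X , x) =
    (u , Q.med₂ T t c) , tt ,
    λ { (v , vc) _ → Q.med-unique T t c v
          (begin
            Q.q₁ T t ∘ v                         ≈⟨ ≈-sym identityˡ ⟩
            id ∘ (Q.q₁ T t ∘ v)                  ≈⟨ ≈-sym ▶st ⟩∘⟨refl ⟩
            ▶₁ (s ∘ t) ∘ (Q.q₁ T t ∘ v)          ≈⟨ F-∘ ⟩∘⟨refl ⟩
            (▶₁ s ∘ ▶₁ t) ∘ (Q.q₁ T t ∘ v)       ≈⟨ pullʳ (pullˡ (Q.comm T t)) ⟩
            ▶₁ s ∘ ((next I ∘ Q.q₂ T t) ∘ v)     ≈⟨ refl⟩∘⟨ pullʳ vc ⟩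
            ▶₁ s ∘ (next I ∘ x)                  ∎)
          vc }
    where
    s : Hom I T
    s = proj₁ (proj₁ (isT (I , id)))
    ts : t ∘ s ≈ id
    ts = proj₂ (proj₁ (isT (I , id)))
    st : s ∘ t ≈ id
    st = terminal-unique EI isT (s ∘ t , ≈-trans sym-assoc (≈-trans (ts ⟩∘⟨refl) identityˡ)) EI.id
    ▶st : ▶₁ (s ∘ t) ≈ id
    ▶st = ≈-trans (F-resp-≈ st) F-id
    c : ▶₁ t ∘ (▶₁ s ∘ (next I ∘ x)) ≈ next I ∘ x
    c = ≈-trans (pullˡ (≈-trans (≈-sym F-∘) (≈-trans (F-resp-≈ ts) F-id))) identityˡ
    u : Hom X (Q.Q T t)
    u = Q.med T t (▶₁ s ∘ (next I ∘ x)) x c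

  ▶I₁-q₁∘ : ∀ {A a B b} (f : EI.Hom (A , a) (B , b)) {W} (u : Hom W (Q.Q A a)) →
            Q.q₁ B b ∘ (proj₁ (▶I₁ {A , a} {B , b} f) ∘ u) ≈ ▶₁ (proj₁ f) ∘ (Q.q₁ A a ∘ u)
  ▶I₁-q₁∘ f u = ≈-trans (pullˡ (▶I₁-q₁ f)) assoc
  ▶I₁-q₂∘ : ∀ {A a B b} (f : EI.Hom (A , a) (B , b)) {W} (u : Hom W (Q.Q A a)) →
            Q.q₂ B b ∘ (proj₁ (▶I₁ {A , a} {B , b} f) ∘ u) ≈ Q.q₂ A a ∘ u
  ▶I₁-q₂∘ {A} {a} {B} {b} f u = pullˡ (proj₂ (▶I₁ {A , a} {B , b} f))

  slicePullback⇒pullback :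
    ∀ {A a B b Z z P p} (f : EI.Hom (A , a) (Z , z)) (g : EI.Hom (B , b) (Z , z))
      (p₁ : EI.Hom (P , p) (A , a)) (p₂ : EI.Hom (P , p) (B , b)) →
    IsPullback EI f g p₁ p₂ → IsPullback E (proj₁ f) (proj₁ g) (proj₁ p₁) (proj₁ p₂)
  slicePullback⇒pullback {A} {a} {B} {b} {Z} {z} {P} {p}
                         (f , fc) (g , gc) (p₁ , p₁c) (p₂ , p₂c) (comm , universal) =
    comm , λ X h k c →
      let kc : b ∘ k ≈ a ∘ h
          kc = begin
            b ∘ k       ≈⟨ ≈-sym gc ⟩∘⟨refl ⟩
            (z ∘ g) ∘ k ≈⟨ pullʳ (≈-sym c) ⟩
            z ∘ (f ∘ h) ≈⟨ sym-assoc ⟩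
            (z ∘ f) ∘ h ≈⟨ fc ⟩∘⟨refl ⟩
            a ∘ h       ∎
          r = universal (X , a ∘ h) (h , ≈-refl) (k , kc) c
      in proj₁ (proj₁ r) , proj₁ (proj₂ r) ,
         λ v ev → proj₂ (proj₂ r) (v , ≈-trans (≈-sym p₁c ⟩∘⟨refl) (pullʳ (proj₁ ev))) ev

  -- ▶_I preserves pullbacks: the legs of a cone into ▶_I of the square give
  -- a cone into ▶ of the square in E, a pullback since ▶ preserves it
  ▶I-presPullback : ∀ {A B Z P} (f : EI.Hom A Z) (g : EI.Hom B Z) (p₁ : EI.Hom P A)
                    (p₂ : EI.Hom P B) → IsPullback EI f g p₁ p₂ →
                    IsPullback EI (▶I₁ {A} {Z} f) (▶I₁ {B} {Z} g)
                                  (▶I₁ {P} {A} p₁) (▶I₁ {P} {B} p₂)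
  ▶I-presPullback {A , a} {B , b} {Z , z} {P , p} f g p₁ p₂ isPB = comm' , universal
    where
    module QA = Q A a
    module QB = Q B b
    module QZ = Q Z z
    module QP = Q P p
    ▶f : EI.Hom (▶I₀ (A , a)) (▶I₀ (Z , z))
    ▶f = ▶I₁ {A , a} {Z , z} f
    ▶g : EI.Hom (▶I₀ (B , b)) (▶I₀ (Z , z))
    ▶g = ▶I₁ {B , b} {Z , z} g
    ▶p₁ : EI.Hom (▶I₀ (P , p)) (▶I₀ (A , a))
    ▶p₁ = ▶I₁ {P , p} {A , a} p₁
    ▶p₂ : EI.Hom (▶I₀ (P , p)) (▶I₀ (B , b))
    ▶p₂ = ▶I₁ {P , p} {B , b} p₂
    f' : Hom QA.Q QZ.Q
    f' = proj₁ ▶f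
    g' : Hom QB.Q QZ.Q
    g' = proj₁ ▶g
    p₁' : Hom QP.Q QA.Q
    p₁' = proj₁ ▶p₁
    p₂' : Hom QP.Q QB.Q
    p₂' = proj₁ ▶p₂
    module ▶PB = PullbackProps
      (pres-pullback _ _ _ _ (slicePullback⇒pullback f g p₁ p₂ isPB))
    comm' : f' ∘ p₁' ≈ g' ∘ p₂'
    comm' = QZ.jointly-monic
      (begin
        QZ.q₁ ∘ (f' ∘ p₁')                          ≈⟨ ▶I₁-q₁∘ f p₁' ⟩
        ▶₁ (proj₁ f) ∘ (QA.q₁ ∘ p₁')                ≈⟨ refl⟩∘⟨ ▶I₁-q₁ p₁ ⟩
        ▶₁ (proj₁ f) ∘ (▶₁ (proj₁ p₁) ∘ QP.q₁)      ≈⟨ sym-assoc ⟩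
        (▶₁ (proj₁ f) ∘ ▶₁ (proj₁ p₁)) ∘ QP.q₁      ≈⟨ ▶PB.comm ⟩∘⟨refl ⟩
        (▶₁ (proj₁ g) ∘ ▶₁ (proj₁ p₂)) ∘ QP.q₁      ≈⟨ assoc ⟩
        ▶₁ (proj₁ g) ∘ (▶₁ (proj₁ p₂) ∘ QP.q₁)      ≈⟨ refl⟩∘⟨ ≈-sym (▶I₁-q₁ p₂) ⟩
        ▶₁ (proj₁ g) ∘ (QB.q₁ ∘ p₂')                ≈⟨ ≈-sym (▶I₁-q₁∘ g p₂') ⟩
        QZ.q₁ ∘ (g' ∘ p₂')                          ∎)
      (≈-trans (▶I₁-q₂∘ f p₁') (≈-trans (proj₂ (▶I₁ {P , p} {A , a} p₁))
        (≈-sym (≈-trans (▶I₁-q₂∘ g p₂') (proj₂ (▶I₁ {P , p} {B , b} p₂))))))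
    universal : ∀ Y (h : EI.Hom Y (▶I₀ (A , a))) (k : EI.Hom Y (▶I₀ (B , b))) →
                ▶f EI.∘ h EI.≈ ▶g EI.∘ k →
                EI.∃!Hom Y (▶I₀ (P , p)) (λ u → (▶p₁ EI.∘ u EI.≈ h) × (▶p₂ EI.∘ u EI.≈ k))
    universal (X , x) (h , hc) (k , kc) c = (u , QP.med₂ cP) , (e₁ , e₂) , unique
      where
      c▶ : ▶₁ (proj₁ f) ∘ (QA.q₁ ∘ h) ≈ ▶₁ (proj₁ g) ∘ (QB.q₁ ∘ k)
      c▶ = begin
        ▶₁ (proj₁ f) ∘ (QA.q₁ ∘ h) ≈⟨ ≈-sym (▶I₁-q₁∘ f h) ⟩
        QZ.q₁ ∘ (f' ∘ h)           ≈⟨ refl⟩∘⟨ c ⟩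
        QZ.q₁ ∘ (g' ∘ k)           ≈⟨ ▶I₁-q₁∘ g k ⟩
        ▶₁ (proj₁ g) ∘ (QB.q₁ ∘ k) ∎
      m : Hom X (▶₀ P)
      m = ▶PB.med (QA.q₁ ∘ h) (QB.q₁ ∘ k) c▶
      cP : ▶₁ p ∘ m ≈ next I ∘ x
      cP = begin
        ▶₁ p ∘ m                   ≈⟨ F-resp-≈ (≈-sym (proj₂ p₁)) ⟩∘⟨refl ⟩
        ▶₁ (a ∘ proj₁ p₁) ∘ m      ≈⟨ F-∘ ⟩∘⟨refl ⟩
        (▶₁ a ∘ ▶₁ (proj₁ p₁)) ∘ m ≈⟨ pullʳ (▶PB.med₁ c▶) ⟩
        ▶₁ a ∘ (QA.q₁ ∘ h)         ≈⟨ pullˡ QA.comm ⟩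
        (next I ∘ QA.q₂) ∘ h       ≈⟨ pullʳ hc ⟩
        next I ∘ x                 ∎
      u : Hom X QP.Q
      u = QP.med m x cP
      e₁ : p₁' ∘ u ≈ h
      e₁ = QA.jointly-monic
             (≈-trans (▶I₁-q₁∘ p₁ u) (≈-trans (refl⟩∘⟨ QP.med₁ cP) (▶PB.med₁ c▶)))
             (≈-trans (▶I₁-q₂∘ p₁ u) (≈-trans (QP.med₂ cP) (≈-sym hc)))
      e₂ : p₂' ∘ u ≈ k
      e₂ = QB.jointly-monic
             (≈-trans (▶I₁-q₁∘ p₂ u) (≈-trans (refl⟩∘⟨ QP.med₁ cP) (▶PB.med₂ c▶)))
             (≈-trans (▶I₁-q₂∘ p₂ u) (≈-trans (QP.med₂ cP) (≈-sym kc)))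
      unique : ∀ v → (▶p₁ EI.∘ v EI.≈ (h , hc)) × (▶p₂ EI.∘ v EI.≈ (k , kc)) →
               v EI.≈ (u , QP.med₂ cP)
      unique (v , vc) (ev₁ , ev₂) = QP.med-unique cP v
        (▶PB.med-unique c▶ (QP.q₁ ∘ v)
          (≈-trans (≈-sym (▶I₁-q₁∘ p₁ v)) (refl⟩∘⟨ ev₁))
          (≈-trans (≈-sym (▶I₁-q₁∘ p₂ v)) (refl⟩∘⟨ ev₂)))
        vc

transferUniqueFixedPoint :
  ∀ {a ℓ₁ b ℓ₂} (A : Setoid a ℓ₁) (B : Setoid b ℓ₂) →
  let module A = Setoid A
      module B = Setoid B in
  (σ : A.Carrier → B.Carrier) →
  (∀ {x y} → x A.≈ y → σ x B.≈ σ y) →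
  (∀ {x y} → σ x B.≈ σ y → x A.≈ y) →
  (∀ y → Σ[ x ∈ A.Carrier ] σ x B.≈ y) →
  (Φ : A.Carrier → A.Carrier) (Ψ : B.Carrier → B.Carrier) →
  (∀ {y z} → y B.≈ z → Ψ y B.≈ Ψ z) →
  (∀ x → σ (Φ x) B.≈ Ψ (σ x)) →
  Σ[ x ∈ A.Carrier ] (Φ x A.≈ x × (∀ x' → Φ x' A.≈ x' → x' A.≈ x)) →
  Σ[ y ∈ B.Carrier ] (Ψ y B.≈ y × (∀ y' → Ψ y' B.≈ y' → y' B.≈ y))
transferUniqueFixedPoint A B σ σ-cong σ-injective σ-surjective Φ Ψ Ψ-cong intertwine
                         (x , x-fixed , x-unique) =
  σ x , σx-fixed , σx-unique
  where
  module B = Setoid B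
  open SetoidReasoning B
  σx-fixed : Ψ (σ x) B.≈ σ x
  σx-fixed = begin
    Ψ (σ x) ≈⟨ B.sym (intertwine x) ⟩
    σ (Φ x) ≈⟨ σ-cong x-fixed ⟩
    σ x     ∎
  σx-unique : ∀ y → Ψ y B.≈ y → y B.≈ σ x
  σx-unique y y-fixed = begin
    y        ≈⟨ B.sym (proj₂ (σ-surjective y)) ⟩
    σ x'     ≈⟨ σ-cong (x-unique x' (σ-injective σx'-fixed)) ⟩
    σ x      ∎
    where
    x' : Setoid.Carrier A
    x' = proj₁ (σ-surjective y)
    σx'-fixed : σ (Φ x') B.≈ σ x'
    σx'-fixed = begin
      σ (Φ x') ≈⟨ intertwine x' ⟩
      Ψ (σ x') ≈⟨ Ψ-cong (proj₂ (σ-surjective y)) ⟩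
      Ψ y      ≈⟨ y-fixed ⟩
      y        ≈⟨ B.sym (proj₂ (σ-surjective y)) ⟩
      σ x'     ∎

-- Part 3: guarded fixed points in E/I.
module SliceGuardedFix {o ℓ e} (E : Category o ℓ e) (L : LCCC E) (M : GuardedModel E)
                       (I : Category.Obj E) where
  open CategoryReasoning E
  open SliceLater E L M I
  open LCCC L using (pullback)
  open GuardedModel M
  open IsGuardedModel isGuardedModel
  open IsEndofunctor isEndofunctor
  open PreservesFiniteLimits presFinLimits
  open SliceLaterFunctor E L M I using (EI; module EI; module Q; nextI-q₁)
  open HasFiniteProducts finiteProducts using (𝟙; terminal)

  ! : ∀ X → Hom X 𝟙
  ! X = proj₁ (Terminal.isTerminal terminal X)

  !-unique : ∀ {X} (u v : Hom X 𝟙) → u ≈ v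
  !-unique = terminal-unique E (Terminal.isTerminal terminal)

  ▶𝟙-unique : ∀ {X} (u v : Hom X (▶₀ 𝟙)) → u ≈ v
  ▶𝟙-unique = terminal-unique E (pres-terminal 𝟙 (Terminal.isTerminal terminal))

  -- Products and exponentials are taken in the cartesian closed slice E/𝟙,
  -- whose objects are objects of E with their (unique) map to 𝟙.
  E𝟙 : Category (o ⊔ ℓ) (ℓ ⊔ e) e
  E𝟙 = Slice E 𝟙
  module E𝟙 = Category E𝟙
  open CartesianClosed (LCCC.sliceCartClosed L 𝟙)
    renaming (finiteProducts to finiteProducts𝟙; exponential to exponential𝟙)
  open HasFiniteProducts finiteProducts𝟙 using (product; _⁂id)

  ⌊_⌋ : Obj → E𝟙.Obj
  ⌊ X ⌋ = X , ! X

  Iₒ : E𝟙.Obj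
  Iₒ = ⌊ I ⌋

  module Over𝟙Product (a b : E𝟙.Obj) where
    private
      Pr : Product E𝟙 a b
      Pr = product a b
      open ProductProps Pr
    obj : Obj
    obj = proj₁ (Product.A×B Pr)
    π₁ : Hom obj (proj₁ a)
    π₁ = proj₁ (Product.π₁ Pr)
    π₂ : Hom obj (proj₁ b)
    π₂ = proj₁ (Product.π₂ Pr)
    ⟨_,_⟩ : ∀ {X} → Hom X (proj₁ a) → Hom X (proj₁ b) → Hom X obj
    ⟨ h , k ⟩ = proj₁ (Product.⟨_,_⟩ Pr {_ , ! _} (h , !-unique _ _) (k , !-unique _ _))
    β₁ : ∀ {X} {h : Hom X (proj₁ a)} {k : Hom X (proj₁ b)} → π₁ ∘ ⟨ h , k ⟩ ≈ h
    β₁ = pair-β₁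
    β₂ : ∀ {X} {h : Hom X (proj₁ a)} {k : Hom X (proj₁ b)} → π₂ ∘ ⟨ h , k ⟩ ≈ k
    β₂ = pair-β₂
    unique : ∀ {X} {h : Hom X (proj₁ a)} {k : Hom X (proj₁ b)} (v : Hom X obj) →
             π₁ ∘ v ≈ h → π₂ ∘ v ≈ k → v ≈ ⟨ h , k ⟩
    unique v e₁ e₂ = pair-unique (v , !-unique _ _) e₁ e₂
    jointly-monic : ∀ {X} {u v : Hom X obj} → π₁ ∘ u ≈ π₁ ∘ v → π₂ ∘ u ≈ π₂ ∘ v → u ≈ v
    jointly-monic {u = u} {v} e₁ e₂ = ≈-trans (unique u e₁ e₂) (≈-sym (unique v ≈-refl ≈-refl))
    isPullback : IsPullback E (proj₂ a) (proj₂ b) π₁ π₂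
    isPullback = !-unique _ _ ,
                 λ X h k _ → ⟨ h , k ⟩ , (β₁ , β₂) , λ v ev → unique v (proj₁ ev) (proj₂ ev)

  module ⊗ (X : Obj) = Over𝟙Product ⌊ X ⌋ Iₒ

  _⊗I : Obj → Obj
  X ⊗I = ⊗.obj X

  _×I : ∀ {Y W} → Hom Y W → Hom (Y ⊗I) (W ⊗I)
  _×I {Y} {W} u = ⊗.⟨_,_⟩ W (u ∘ ⊗.π₁ Y) (⊗.π₂ Y)

  π₁-×I : ∀ {Y W} {u : Hom Y W} → ⊗.π₁ W ∘ (u ×I) ≈ u ∘ ⊗.π₁ Y
  π₁-×I {W = W} = ⊗.β₁ W

  π₂-×I : ∀ {Y W} {u : Hom Y W} → ⊗.π₂ W ∘ (u ×I) ≈ ⊗.π₂ Y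
  π₂-×I {W = W} = ⊗.β₂ W

  ×I-resp : ∀ {Y W} {u v : Hom Y W} → u ≈ v → u ×I ≈ v ×I
  ×I-resp {W = W} e = ⊗.unique W _ (≈-trans π₁-×I (e ⟩∘⟨refl)) π₂-×I

  ×I-∘ : ∀ {Y Z W} {u : Hom Z W} {v : Hom Y Z} → (u ∘ v) ×I ≈ (u ×I) ∘ (v ×I)
  ×I-∘ {W = W} {u} {v} = ≈-sym (⊗.unique W _
    (begin
      ⊗.π₁ W ∘ ((u ×I) ∘ (v ×I)) ≈⟨ pullˡ π₁-×I ⟩
      (u ∘ ⊗.π₁ _) ∘ (v ×I)      ≈⟨ pullʳ π₁-×I ⟩
      u ∘ (v ∘ ⊗.π₁ _)           ≈⟨ sym-assoc ⟩
      (u ∘ v) ∘ ⊗.π₁ _           ∎)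
    (≈-trans (pullˡ π₂-×I) π₂-×I))

  module Power (X : Obj) where
    private
      module Exp = Exponential (exponential𝟙 Iₒ ⌊ X ⌋)
      module WI = Over𝟙Product Exp.B^A Iₒ

      curry : ∀ Y (h : Hom (Y ⊗I) X) →
              E𝟙.∃!Hom ⌊ Y ⌋ Exp.B^A
                (λ u → Exp.eval E𝟙.∘ _⁂id {⌊ Y ⌋} {Exp.B^A} {Iₒ} u E𝟙.≈ (h , !-unique _ _))
      curry Y h = Exp.curry ⌊ Y ⌋ (h , !-unique _ _)

    W : Obj
    W = proj₁ Exp.B^A

    -- W × I computed from ⌊ W ⌋ agrees with the product of the object B^A
    private
      compare : Hom (W ⊗I) WI.obj
      compare = WI.⟨ ⊗.π₁ W , ⊗.π₂ W ⟩

      compare-×I : ∀ {Y} (u : E𝟙.Hom ⌊ Y ⌋ Exp.B^A) →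
                   compare ∘ (proj₁ u ×I) ≈ proj₁ (_⁂id {⌊ Y ⌋} {Exp.B^A} {Iₒ} u)
      compare-×I {Y} u = WI.jointly-monic
        (≈-trans (pullˡ WI.β₁) (≈-trans π₁-×I (≈-sym (ProductProps.pair-β₁ (product Exp.B^A Iₒ)))))
        (≈-trans (pullˡ WI.β₂) (≈-trans π₂-×I (≈-sym (ProductProps.pair-β₂ (product Exp.B^A Iₒ)))))

    ev : Hom (W ⊗I) X
    ev = proj₁ Exp.eval ∘ compare

    cur : ∀ Y → Hom (Y ⊗I) X → Hom Y W
    cur Y h = proj₁ (proj₁ (curry Y h))

    cur-β : ∀ Y {h : Hom (Y ⊗I) X} → ev ∘ (cur Y h ×I) ≈ h
    cur-β Y {h} =
      ≈-trans (pullʳ (compare-×I (proj₁ (curry Y h)))) (proj₁ (proj₂ (curry Y h)))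

    cur-unique : ∀ Y {h : Hom (Y ⊗I) X} (v : Hom Y W) → ev ∘ (v ×I) ≈ h → v ≈ cur Y h
    cur-unique Y {h} v e = proj₂ (proj₂ (curry Y h)) (v , !-unique _ _)
      (≈-trans (≈-sym (pullʳ (compare-×I (v , !-unique _ _)))) e)

  -- An object of sections Π_I X of p : X → I: maps Y → S correspond to
  -- I-indexed families of sections Y × I → X of p.
  record SectionObject (X : Obj) (p : Hom X I) : Set (o ⊔ ℓ ⊔ e) where
    field
      S           : Obj
      evS         : Hom (S ⊗I) X
      evS-over    : p ∘ evS ≈ ⊗.π₂ S
      curS        : ∀ Y (h : Hom (Y ⊗I) X) → p ∘ h ≈ ⊗.π₂ Y → Hom Y S
      curS-β      : ∀ Y {h} (c : p ∘ h ≈ ⊗.π₂ Y) → evS ∘ (curS Y h c ×I) ≈ h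
      curS-unique : ∀ Y {h} (c : p ∘ h ≈ ⊗.π₂ Y) (v : Hom Y S) →
                    evS ∘ (v ×I) ≈ h → v ≈ curS Y h c

    evS-family : ∀ {Y} (w : Hom Y S) → p ∘ (evS ∘ (w ×I)) ≈ ⊗.π₂ Y
    evS-family w = ≈-trans (pullˡ evS-over) π₂-×I

  -- S is the pullback of p^I : X^I → I^I along the name of id_I
  sectionObject : ∀ X (p : Hom X I) → SectionObject X p
  sectionObject X p = record
    { S = S
    ; evS = XI.ev ∘ (ι ×I)
    ; evS-over = square⇒family ι σ SP.comm
    ; curS = curS
    ; curS-β = curS-β
    ; curS-unique = λ Y c v e → SP.med-unique _ v
        (XI.cur-unique Y (ι ∘ v) (≈-trans (refl⟩∘⟨ ×I-∘) (≈-trans sym-assoc e)))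
        (!-unique _ _) }
    where
    module XI = Power X
    module II = Power I

    pᴵ : Hom XI.W II.W
    pᴵ = II.cur XI.W (p ∘ XI.ev)

    idᴵ : Hom 𝟙 II.W
    idᴵ = II.cur 𝟙 (⊗.π₂ 𝟙)

    open Pullback (pullback pᴵ idᴵ) renaming (P to S; p₁ to ι; p₂ to σ)
    module SP = PullbackProps isPullback

    pᴵ-name : ∀ {Y} (w : Hom Y XI.W) → II.ev ∘ ((pᴵ ∘ w) ×I) ≈ p ∘ (XI.ev ∘ (w ×I))
    pᴵ-name w = begin
      II.ev ∘ ((pᴵ ∘ w) ×I)        ≈⟨ refl⟩∘⟨ ×I-∘ ⟩
      II.ev ∘ ((pᴵ ×I) ∘ (w ×I))   ≈⟨ sym-assoc ⟩
      (II.ev ∘ (pᴵ ×I)) ∘ (w ×I)   ≈⟨ II.cur-β XI.W ⟩∘⟨refl ⟩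
      (p ∘ XI.ev) ∘ (w ×I)         ≈⟨ assoc ⟩
      p ∘ (XI.ev ∘ (w ×I))         ∎

    idᴵ-name : ∀ {Y} (t : Hom Y 𝟙) → II.ev ∘ ((idᴵ ∘ t) ×I) ≈ ⊗.π₂ Y
    idᴵ-name t = begin
      II.ev ∘ ((idᴵ ∘ t) ×I)       ≈⟨ refl⟩∘⟨ ×I-∘ ⟩
      II.ev ∘ ((idᴵ ×I) ∘ (t ×I))  ≈⟨ sym-assoc ⟩
      (II.ev ∘ (idᴵ ×I)) ∘ (t ×I)  ≈⟨ II.cur-β 𝟙 ⟩∘⟨refl ⟩
      ⊗.π₂ 𝟙 ∘ (t ×I)              ≈⟨ π₂-×I ⟩
      ⊗.π₂ _                       ∎

    square⇒family : ∀ {Y} (w : Hom Y XI.W) (t : Hom Y 𝟙) →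
                    pᴵ ∘ w ≈ idᴵ ∘ t → p ∘ (XI.ev ∘ (w ×I)) ≈ ⊗.π₂ Y
    square⇒family w t c =
      ≈-trans (≈-sym (pᴵ-name w)) (≈-trans (refl⟩∘⟨ ×I-resp c) (idᴵ-name t))

    family⇒square : ∀ {Y} (w : Hom Y XI.W) (t : Hom Y 𝟙) →
                    p ∘ (XI.ev ∘ (w ×I)) ≈ ⊗.π₂ Y → pᴵ ∘ w ≈ idᴵ ∘ t
    family⇒square {Y} w t c =
      ≈-trans (II.cur-unique Y (pᴵ ∘ w) (≈-trans (pᴵ-name w) c))
              (≈-sym (II.cur-unique Y (idᴵ ∘ t) (idᴵ-name t)))

    inS : ∀ Y {h : Hom (Y ⊗I) X} → p ∘ h ≈ ⊗.π₂ Y → pᴵ ∘ XI.cur Y h ≈ idᴵ ∘ ! Y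
    inS Y c = family⇒square _ (! Y) (≈-trans (refl⟩∘⟨ XI.cur-β Y) c)

    curS : ∀ Y (h : Hom (Y ⊗I) X) → p ∘ h ≈ ⊗.π₂ Y → Hom Y S
    curS Y h c = SP.med (XI.cur Y h) (! Y) (inS Y c)

    curS-β : ∀ Y {h} (c : p ∘ h ≈ ⊗.π₂ Y) → (XI.ev ∘ (ι ×I)) ∘ (curS Y h c ×I) ≈ h
    curS-β Y {h} c = begin
      (XI.ev ∘ (ι ×I)) ∘ (curS Y h c ×I)   ≈⟨ pullʳ (≈-sym ×I-∘) ⟩
      XI.ev ∘ ((ι ∘ curS Y h c) ×I)        ≈⟨ refl⟩∘⟨ ×I-resp (SP.med₁ (inS Y c)) ⟩
      XI.ev ∘ (XI.cur Y h ×I)              ≈⟨ XI.cur-β Y ⟩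
      h                                    ∎

  -- Points 𝟙 → S correspond bijectively to sections of p, i.e. to maps
  -- (I , id) → (X , p) of E/I, via I ≅ 𝟙 × I.
  module Points {X p} (SO : SectionObject X p) where
    open SectionObject SO

    e₀ : Hom I (𝟙 ⊗I)
    e₀ = ⊗.⟨_,_⟩ 𝟙 (! I) id

    e₀-π₂ : e₀ ∘ ⊗.π₂ 𝟙 ≈ id
    e₀-π₂ = ⊗.jointly-monic 𝟙 (!-unique _ _)
      (≈-trans (pullˡ (⊗.β₂ 𝟙)) (≈-trans identityˡ (≈-sym identityʳ)))

    toSection : Hom 𝟙 S → EI.Hom (I , id) (X , p)
    toSection u = evS ∘ ((u ×I) ∘ e₀) ,
      ≈-trans (refl⟩∘⟨ sym-assoc) (≈-trans (pullˡ (evS-family u)) (⊗.β₂ 𝟙))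

    toSection-cong : ∀ {u v} → u ≈ v → proj₁ (toSection u) ≈ proj₁ (toSection v)
    toSection-cong e = refl⟩∘⟨ ×I-resp e ⟩∘⟨refl

    evS-point : ∀ u → evS ∘ (u ×I) ≈ proj₁ (toSection u) ∘ ⊗.π₂ 𝟙
    evS-point u = begin
      evS ∘ (u ×I)                      ≈⟨ ≈-sym identityʳ ⟩
      (evS ∘ (u ×I)) ∘ id               ≈⟨ refl⟩∘⟨ ≈-sym e₀-π₂ ⟩
      (evS ∘ (u ×I)) ∘ (e₀ ∘ ⊗.π₂ 𝟙)    ≈⟨ sym-assoc ⟩
      ((evS ∘ (u ×I)) ∘ e₀) ∘ ⊗.π₂ 𝟙    ≈⟨ assoc ⟩∘⟨refl ⟩
      (evS ∘ ((u ×I) ∘ e₀)) ∘ ⊗.π₂ 𝟙    ∎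

    toSection-injective : ∀ {u v} → proj₁ (toSection u) ≈ proj₁ (toSection v) → u ≈ v
    toSection-injective {u} {v} e =
      ≈-trans (curS-unique 𝟙 (evS-family v) u
                 (≈-trans (evS-point u) (≈-trans (e ⟩∘⟨refl) (≈-sym (evS-point v)))))
              (≈-sym (curS-unique 𝟙 (evS-family v) v ≈-refl))

    toSection-surjective : ∀ (h : EI.Hom (I , id) (X , p)) →
                           Σ[ u ∈ Hom 𝟙 S ] proj₁ (toSection u) ≈ proj₁ h
    toSection-surjective (h , hc) = u , (begin
      evS ∘ ((u ×I) ∘ e₀)     ≈⟨ sym-assoc ⟩
      (evS ∘ (u ×I)) ∘ e₀     ≈⟨ curS-β 𝟙 c ⟩∘⟨refl ⟩
      (h ∘ ⊗.π₂ 𝟙) ∘ e₀       ≈⟨ pullʳ (⊗.β₂ 𝟙) ⟩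
      h ∘ id                  ≈⟨ identityʳ ⟩
      h                       ∎)
      where
      c : p ∘ (h ∘ ⊗.π₂ 𝟙) ≈ ⊗.π₂ 𝟙
      c = ≈-trans (pullˡ hc) identityˡ
      u : Hom 𝟙 S
      u = curS 𝟙 (h ∘ ⊗.π₂ 𝟙) c

  -- ▶A × I → ▶(A × I), pairing ▶π₁ with next_I ∘ π₂; it exists because ▶
  -- preserves the product A × I, a pullback over 𝟙
  module LaterPair (A : Obj) where
    private
      module ▶⊗ = PullbackProps (pres-pullback _ _ _ _ (⊗.isPullback A))

    laterPair : Hom (▶₀ A ⊗I) (▶₀ (A ⊗I))
    laterPair = ▶⊗.med (⊗.π₁ (▶₀ A)) (next I ∘ ⊗.π₂ (▶₀ A)) (▶𝟙-unique _ _)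

    laterPair-π₂ : ▶₁ (⊗.π₂ A) ∘ laterPair ≈ next I ∘ ⊗.π₂ (▶₀ A)
    laterPair-π₂ = ▶⊗.med₂ _

    laterPair-next : laterPair ∘ (next A ×I) ≈ next (A ⊗I)
    laterPair-next = ▶⊗.jointly-monic
      (begin
        ▶₁ (⊗.π₁ A) ∘ (laterPair ∘ (next A ×I)) ≈⟨ pullˡ (▶⊗.med₁ _) ⟩
        ⊗.π₁ (▶₀ A) ∘ (next A ×I)               ≈⟨ π₁-×I ⟩
        next A ∘ ⊗.π₁ A                         ≈⟨ nextNatural _ ⟩
        ▶₁ (⊗.π₁ A) ∘ next (A ⊗I)               ∎)
      (begin
        ▶₁ (⊗.π₂ A) ∘ (laterPair ∘ (next A ×I)) ≈⟨ pullˡ laterPair-π₂ ⟩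
        (next I ∘ ⊗.π₂ (▶₀ A)) ∘ (next A ×I)    ≈⟨ pullʳ π₂-×I ⟩
        next I ∘ ⊗.π₂ A                         ≈⟨ nextNatural _ ⟩
        ▶₁ (⊗.π₂ A) ∘ next (A ⊗I)               ∎)

  -- A map f : ▶_I (X , p) → (X , p) induces F : ▶S → S, the curried form of
  -- ▶S × I → ▶(S × I) → ▶_I X → X, such that F ∘ next corresponds to
  -- f ∘ next_I under the correspondence between points and sections.
  module Step {X p} (SO : SectionObject X p) (f : EI.Hom (▶I₀ (X , p)) (X , p)) where
    open SectionObject SO
    open LaterPair S
    module QX = Q X p

    n : Hom X QX.Q
    n = proj₁ (nextI (X , p))

    g-square : ▶₁ p ∘ (▶₁ evS ∘ laterPair) ≈ next I ∘ ⊗.π₂ (▶₀ S)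
    g-square = begin
      ▶₁ p ∘ (▶₁ evS ∘ laterPair) ≈⟨ sym-assoc ⟩
      (▶₁ p ∘ ▶₁ evS) ∘ laterPair ≈⟨ ≈-trans (≈-sym F-∘) (F-resp-≈ evS-over) ⟩∘⟨refl ⟩
      ▶₁ (⊗.π₂ S) ∘ laterPair     ≈⟨ laterPair-π₂ ⟩
      next I ∘ ⊗.π₂ (▶₀ S)        ∎

    g : Hom (▶₀ S ⊗I) QX.Q
    g = QX.med (▶₁ evS ∘ laterPair) (⊗.π₂ (▶₀ S)) g-square

    g-next : g ∘ (next S ×I) ≈ n ∘ evS
    g-next = QX.jointly-monic
      (begin
        QX.q₁ ∘ (g ∘ (next S ×I))              ≈⟨ pullˡ (QX.med₁ g-square) ⟩
        (▶₁ evS ∘ laterPair) ∘ (next S ×I)     ≈⟨ pullʳ laterPair-next ⟩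
        ▶₁ evS ∘ next (S ⊗I)                   ≈⟨ ≈-sym (nextNatural evS) ⟩
        next X ∘ evS                           ≈⟨ pushˡ (nextI-q₁ X p) ⟩
        QX.q₁ ∘ (n ∘ evS)                      ∎)
      (begin
        QX.q₂ ∘ (g ∘ (next S ×I))              ≈⟨ pullˡ (QX.med₂ g-square) ⟩
        ⊗.π₂ (▶₀ S) ∘ (next S ×I)              ≈⟨ π₂-×I ⟩
        ⊗.π₂ S                                 ≈⟨ ≈-sym evS-over ⟩
        p ∘ evS                                ≈⟨ pushˡ (proj₂ (nextI (X , p))) ⟩
        QX.q₂ ∘ (n ∘ evS)                      ∎)

    F-over : p ∘ (proj₁ f ∘ g) ≈ ⊗.π₂ (▶₀ S)
    F-over = ≈-trans (pullˡ (proj₂ f)) (QX.med₂ g-square)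

    F : Hom (▶₀ S) S
    F = curS (▶₀ S) (proj₁ f ∘ g) F-over

    F-next : evS ∘ ((F ∘ next S) ×I) ≈ proj₁ f ∘ (n ∘ evS)
    F-next = begin
      evS ∘ ((F ∘ next S) ×I)          ≈⟨ refl⟩∘⟨ ×I-∘ ⟩
      evS ∘ ((F ×I) ∘ (next S ×I))     ≈⟨ sym-assoc ⟩
      (evS ∘ (F ×I)) ∘ (next S ×I)     ≈⟨ curS-β (▶₀ S) F-over ⟩∘⟨refl ⟩
      (proj₁ f ∘ g) ∘ (next S ×I)      ≈⟨ pullʳ g-next ⟩
      proj₁ f ∘ (n ∘ evS)              ∎

    open Points SO

    intertwine : ∀ u → proj₁ (toSection (F ∘ (next S ∘ u))) ≈
                       proj₁ f ∘ (n ∘ proj₁ (toSection u))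
    intertwine u = begin
      evS ∘ (((F ∘ (next S ∘ u)) ×I) ∘ e₀)          ≈⟨ refl⟩∘⟨ split ⟩∘⟨refl ⟩
      evS ∘ (((F ∘ next S) ×I ∘ (u ×I)) ∘ e₀)       ≈⟨ refl⟩∘⟨ assoc ⟩
      evS ∘ ((F ∘ next S) ×I ∘ ((u ×I) ∘ e₀))       ≈⟨ sym-assoc ⟩
      (evS ∘ (F ∘ next S) ×I) ∘ ((u ×I) ∘ e₀)       ≈⟨ F-next ⟩∘⟨refl ⟩
      (proj₁ f ∘ (n ∘ evS)) ∘ ((u ×I) ∘ e₀)         ≈⟨ pullʳ assoc ⟩
      proj₁ f ∘ (n ∘ (evS ∘ ((u ×I) ∘ e₀)))         ∎
      where
      split : (F ∘ (next S ∘ u)) ×I ≈ (F ∘ next S) ×I ∘ (u ×I)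
      split = ≈-trans (×I-resp sym-assoc) ×I-∘

  guardedFixI : ∀ X (f : EI.Hom (▶I₀ X) X) →
                EI.∃!Hom (I , id) X (λ v → f EI.∘ (nextI X EI.∘ v) EI.≈ v)
  guardedFixI (X , p) f =
    transferUniqueFixedPoint (hom-setoid 𝟙 S) (EI.hom-setoid (I , id) (X , p))
      toSection toSection-cong toSection-injective toSection-surjective
      (λ u → F ∘ (next S ∘ u)) (λ v → f EI.∘ (nextI (X , p) EI.∘ v))
      (λ e → refl⟩∘⟨ refl⟩∘⟨ e) intertwine
      (guardedFix S F)
    where
    SO : SectionObject X p
    SO = sectionObject X p
    open SectionObject SO using (S)
    open Points SO
    open Step SO f

theorem6p3 : ∀ {o ℓ e} (E : Category o ℓ e) (L : LCCC E) (M : GuardedModel E)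
    (I : Category.Obj E) →
    LCCC (Slice E I) ×
    Σ[ fp ∈ HasFiniteProducts (Slice E I) ]
    IsGuardedModel (Slice E I) fp
    (SliceLater.▶I₀ E L M I)
    (SliceLater.▶I₁ E L M I)
    (SliceLater.nextI E L M I)
theorem6p3 E L M I =
  sliceLCCC L I ,
  finiteProductsI ,
  record
    { isEndofunctor = ▶I-endofunctor
    ; presFinLimits = record
        { pres-terminal = ▶I-presTerminal
        ; pres-pullback = ▶I-presPullback }
    ; nextNatural = nextI-natural
    ; guardedFix = guardedFixI }
  where
  open SliceLCCC E using (sliceLCCC; sliceTerminal)
  open SliceLaterFunctor E L M I
  open SliceGuardedFix E L M I using (guardedFixI)
  finiteProductsI : HasFiniteProducts (Slice E I)
  finiteProductsI = record
    { terminal = sliceTerminal I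
    ; product = HasFiniteProducts.product
        (CartesianClosed.finiteProducts (LCCC.sliceCartClosed L I)) }
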